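{- For any vertices $u,v$ of a $C_4$-free Helly graph $G$ and any integer $k$ with $0\le k\le dist(u,v)$, the set $L(u,k,v)$ is a clique.
   Context: Graphs are finite, connected, undirected and unweighted, with shortest-path distance $dist$. A graph is Helly if every family of pairwise intersecting balls $N^r[v]=\{u: dist(u,v)\le r\}$ has a nonempty common intersection; it is $C_4$-free if it has no induced 4-cycle. The interval is $I(u,v)=\{w: dist(u,w)+dist(w,v)=dist(u,v)\}$ and the slice is $L(u,k,v)=\{w\in I(u,v): dist(u,w)=k\}$. -}

module Defs where

open import Data.Nat using (ℕ; zero; suc; _+_; _≤_)
open import Data.Fin using (Fin)
open import Data.Product using (Σ; ∃; _×_; _,_)
open import Data.Sum using (_⊎_)
open import Data.Empty using (⊥)
open import Relation.Nullary using (¬_)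
open import Relation.Binary.PropositionalEquality using (_≡_; _≢_)

record Graph : Set₁ where
  field
    n      : ℕ
    Adj    : Fin n → Fin n → Set
    sym    : ∀ {x y} → Adj x y → Adj y x
    irrefl : ∀ {x} → ¬ Adj x x

module _ (G : Graph) where
  open Graph G

  V : Set
  V = Fin n

  data Walk : V → V → ℕ → Set where
    here : ∀ {x} → Walk x x zero
    step : ∀ {x y z k} → Adj x y → Walk y z k → Walk x z (suc k)

  Connected : Set
  Connected = ∀ x y → ∃ λ k → Walk x y k

  Dist : V → V → ℕ → Set
  Dist x y d = Walk x y d × (∀ m → Walk x y m → d ≤ m)

  InBall : V → ℕ → V → Set
  InBall c r w = ∃ λ d → Dist c w d × d ≤ r

  Helly : Set₁
  Helly = (I : Set) (c : I → V) (r : I → ℕ) →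
          (∀ i j → ∃ λ w → InBall (c i) (r i) w × InBall (c j) (r j) w) →
          ∃ λ w → ∀ i → InBall (c i) (r i) w

  C4Free : Set
  C4Free = ∀ a b c d → a ≢ c → b ≢ d →
           Adj a b → Adj b c → Adj c d → Adj d a →
           ¬ Adj a c → ¬ Adj b d → ⊥

  InInterval : V → V → V → Set
  InInterval u v w = Σ ℕ λ a → Σ ℕ λ b → Σ ℕ λ d →
    Dist u w a × Dist w v b × Dist u v d × a + b ≡ d

  InSlice : V → ℕ → V → V → Set
  InSlice u k v w = InInterval u v w × Dist u w k

  IsClique : (V → Set) → Set
  IsClique S = ∀ x y → S x → S y → x ≡ y ⊎ Adj x y

module Submission where

-- Fix a shortest u–v path of length d and call w a vertex of level (k , b)
-- when dist(u,w) = k and dist(w,v) = b with k + b = d.  Two vertices x, y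
-- are "close" when they are not distinct-and-nonadjacent; the argument is
-- carried out for this negative notion, which needs no decidability.
--
--  * Interior vertices of one level that have a common neighbour are close:
--    otherwise Helly yields a common neighbour z of x, y one step nearer to
--    u and a common neighbour w one step nearer to v, and x z y w is an
--    induced 4-cycle (z, w are too far apart to be equal or adjacent).
--  * By induction on k, any two vertices of level (k , b) are close: their
--    predecessors x', y' are close; x' = y' is a common neighbour, and if
--    x' ~ y' Helly on N[x], N[y'], N^b[v] gives a vertex m of the level of
--    x adjacent to y', which again produces forbidden common neighbours.
--  * In a Helly graph adjacency is decidable, so "close" means equal or
--    adjacent, which is the clique property of the slice L(u,k,v).

open import Defs
open import Data.Nat using (ℕ; zero; suc; _+_; _∸_; _≤_; _<_; z≤n; s≤s)
open import Data.Nat.Properties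
  using (≤-refl; ≤-trans; ≤-antisym; <⇒≱; n≤1+n; +-suc; +-mono-≤; +-monoʳ-≤;
         +-cancelˡ-≤; +-cancelʳ-≤; m+n∸m≡n; m+[n∸m]≡n)
open import Data.Fin using (_≟_)
open import Data.Product using (∃; _×_; _,_; proj₁; proj₂)
open import Data.Sum using (_⊎_; inj₁; inj₂)
open import Data.Unit using (⊤; tt)
open import Data.Empty using (⊥; ⊥-elim)
open import Relation.Nullary using (¬_; Dec; yes; no)
open import Relation.Binary.PropositionalEquality
  using (_≡_; _≢_; refl; sym; trans; cong; subst; subst₂)

module Paths (G : Graph) where
  open Graph G using (Adj; irrefl) renaming (sym to adj-sym)

  infixr 5 _++_
  _++_ : ∀ {x y z a b} → Walk G x y a → Walk G y z b → Walk G x z (a + b)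
  here     ++ q = q
  step e p ++ q = step e (p ++ q)

  snoc : ∀ {x y z a} → Walk G x y a → Adj y z → Walk G x z (suc a)
  snoc here       e = step e here
  snoc (step f p) e = step f (snoc p e)

  reverse : ∀ {x y a} → Walk G x y a → Walk G y x a
  reverse here       = here
  reverse (step e p) = snoc (reverse p) (adj-sym e)

  walk-0 : ∀ {x y} → Walk G x y 0 → x ≡ y
  walk-0 here = refl

  walk-1 : ∀ {x y} → Walk G x y 1 → Adj x y
  walk-1 (step e here) = e

  dist-sym : ∀ {x y a} → Dist G x y a → Dist G y x a
  dist-sym (p , minimal) = reverse p , λ m q → minimal m (reverse q)

  dist-unique : ∀ {x y a b} → Dist G x y a → Dist G x y b → a ≡ b
  dist-unique (p , minp) (q , minq) = ≤-antisym (minp _ q) (minq _ p)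

  dist-0 : ∀ {x y} → Dist G x y 0 → x ≡ y
  dist-0 (p , _) = walk-0 p

  dist-adj : ∀ {x y} → Adj x y → Dist G x y 1
  dist-adj {x} e = step e here , shortest
    where
    shortest : ∀ m → Walk G x _ m → 1 ≤ m
    shortest zero    q = ⊥-elim (irrefl (subst (Adj x) (sym (walk-0 q)) e))
    shortest (suc m) q = s≤s z≤n

  dist-pred : ∀ {u x k} → Dist G u x (suc k) → ∃ λ x' → Adj x x' × Dist G u x' k
  dist-pred {u} {x} {k} (p , minimal) with reverse p
  ... | step e q = _ , e , reverse q , shorter
    where
    shorter : ∀ m → Walk G u _ m → k ≤ m
    shorter m r with minimal _ (snoc r (adj-sym e))
    ... | s≤s k≤m = k≤m

  dist-ball : ∀ {c r w} → Dist G c w r → InBall G c r w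
  dist-ball D = _ , D , ≤-refl

  centre : ∀ c r → InBall G c r c
  centre c r = 0 , (here , λ _ _ → z≤n) , z≤n

  adj-ball : ∀ {c z} → Adj c z → InBall G c 1 z
  adj-ball e = dist-ball (dist-adj e)

  ball-0 : ∀ {c z} → InBall G c 0 z → c ≡ z
  ball-0 (zero , D , _) = dist-0 D

  ball-1 : ∀ {c z} → InBall G c 1 z → c ≡ z ⊎ Adj c z
  ball-1 (zero , (p , _) , _)           = inj₁ (walk-0 p)
  ball-1 (suc zero , (p , _) , _)       = inj₂ (walk-1 p)
  ball-1 (suc (suc _) , _ , s≤s ())

  common-neighbour : ∀ {x y z} → x ≢ y → ¬ Adj x y →
                     InBall G x 1 z → InBall G y 1 z → Adj x z × Adj y z
  common-neighbour x≢y ¬xy bx by with ball-1 bx | ball-1 by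
  ... | inj₁ refl | inj₁ refl = ⊥-elim (x≢y refl)
  ... | inj₁ refl | inj₂ yx   = ⊥-elim (¬xy (adj-sym yx))
  ... | inj₂ xy   | inj₁ refl = ⊥-elim (¬xy xy)
  ... | inj₂ xz   | inj₂ yz   = xz , yz

module HellyFacts (G : Graph) (H : Helly G) where
  open Graph G using (Adj; irrefl) renaming (sym to adj-sym)
  open Paths G

  data Three : Set where
    one two three : Three

  helly-3 : ∀ {c₁ r₁ c₂ r₂ c₃ r₃} →
    (∃ λ w → InBall G c₁ r₁ w × InBall G c₂ r₂ w) →
    (∃ λ w → InBall G c₁ r₁ w × InBall G c₃ r₃ w) →
    (∃ λ w → InBall G c₂ r₂ w × InBall G c₃ r₃ w) →
    ∃ λ w → InBall G c₁ r₁ w × InBall G c₂ r₂ w × InBall G c₃ r₃ w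
  helly-3 {c₁} {r₁} {c₂} {r₂} {c₃} {r₃} m₁₂ m₁₃ m₂₃ with H Three c r meets
    where
    c : Three → V G
    c one = c₁
    c two = c₂
    c three = c₃
    r : Three → ℕ
    r one = r₁
    r two = r₂
    r three = r₃
    flip : ∀ {i j} → (∃ λ w → InBall G (c i) (r i) w × InBall G (c j) (r j) w) →
           ∃ λ w → InBall G (c j) (r j) w × InBall G (c i) (r i) w
    flip (w , bi , bj) = w , bj , bi
    meets : ∀ i j → ∃ λ w → InBall G (c i) (r i) w × InBall G (c j) (r j) w
    meets one   one   = c₁ , centre c₁ r₁ , centre c₁ r₁
    meets two   two   = c₂ , centre c₂ r₂ , centre c₂ r₂
    meets three three = c₃ , centre c₃ r₃ , centre c₃ r₃
    meets one   two   = m₁₂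
    meets one   three = m₁₃
    meets two   three = m₂₃
    meets two   one   = flip m₁₂
    meets three one   = flip m₁₃
    meets three two   = flip m₂₃
  ... | w , inAll = w , inAll one , inAll two , inAll three

  -- Adjacency is decidable: apply Helly to N[b] together with the ball
  -- N⁰[a] indexed by the proofs of Adj a b.  The common point is a exactly
  -- when a ∈ N[b], and it lies in N[b] regardless.
  adj-dec : (a b : V G) → Dec (Adj a b)
  adj-dec a b with a ≟ b
  ... | yes refl = no irrefl
  ... | no a≢b with H (⊤ ⊎ Adj a b) c r meets
    where
    c : ⊤ ⊎ Adj a b → V G
    c (inj₁ _) = b
    c (inj₂ _) = a
    r : ⊤ ⊎ Adj a b → ℕ
    r (inj₁ _) = 1
    r (inj₂ _) = 0
    meets : ∀ i j → ∃ λ w → InBall G (c i) (r i) w × InBall G (c j) (r j) w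
    meets (inj₁ _) (inj₁ _) = b , centre b 1 , centre b 1
    meets (inj₂ _) (inj₂ _) = a , centre a 0 , centre a 0
    meets (inj₁ _) (inj₂ e) = a , adj-ball (adj-sym e) , centre a 0
    meets (inj₂ e) (inj₁ _) = a , centre a 0 , adj-ball (adj-sym e)
  ... | w , inAll with w ≟ a
  ...   | no w≢a  = no λ e → w≢a (sym (ball-0 (inAll (inj₂ e))))
  ...   | yes refl with ball-1 (inAll (inj₁ tt))
  ...     | inj₁ refl = ⊥-elim (a≢b refl)
  ...     | inj₂ e    = yes (adj-sym e)

module Geodesics (G : Graph) {u v : V G} {d : ℕ} (Duv : Dist G u v d) where
  open Graph G using (Adj) renaming (sym to adj-sym)
  open Paths G

  Level : ℕ → ℕ → V G → Set
  Level k b w = Dist G u w k × Dist G w v b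

  no-shortcut : ∀ {w a c} → Walk G u w a → Walk G w v c → a + c < d → ⊥
  no-shortcut p q a+c<d = <⇒≱ a+c<d (proj₂ Duv _ (p ++ q))

  on-geodesic : ∀ {w a c} → Walk G u w a → Walk G w v c → a + c ≡ d → Level a c w
  on-geodesic {w} {a} {c} p q a+c≡d = (p , from-u) , (q , to-v)
    where
    from-u : ∀ m → Walk G u w m → a ≤ m
    from-u m p' = +-cancelʳ-≤ c a m
      (subst₂ _≤_ (sym a+c≡d) refl (proj₂ Duv _ (p' ++ q)))
    to-v : ∀ m → Walk G w v m → c ≤ m
    to-v m q' = +-cancelˡ-≤ a c m (subst₂ _≤_ (sym a+c≡d) refl (proj₂ Duv _ (p ++ q')))

  ball-on-geodesic : ∀ {w a b} → Walk G u w a → InBall G v b w → a + b ≡ d → Level a b w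
  ball-on-geodesic {w} {a} {b} p (e , Dvw , e≤b) a+b≡d =
    on-geodesic p (subst (Walk G w v) e≡b (reverse (proj₁ Dvw))) a+b≡d
    where
    b≤e : b ≤ e
    b≤e = +-cancelˡ-≤ a b e
      (subst₂ _≤_ (sym a+b≡d) refl (proj₂ Duv _ (p ++ reverse (proj₁ Dvw))))
    e≡b : e ≡ b
    e≡b = ≤-antisym e≤b b≤e

  level-pred : ∀ {k b x} → suc k + b ≡ d → Level (suc k) b x →
               ∃ λ x' → Adj x x' × Level k (suc b) x'
  level-pred {k} {b} eq (ux , xv) with dist-pred ux
  ... | x' , xx' , ux' =
    x' , xx' , on-geodesic (proj₁ ux') (step (adj-sym xx') (proj₁ xv)) (trans (+-suc k b) eq)

  slice-level : ∀ {k w} → InSlice G u k v w → Level k (d ∸ k) w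
  slice-level {k} ((a , b , d' , Duw' , Dwv , Duv' , a+b≡d') , Duw) =
    Duw , subst (Dist G _ v) b≡d∸k Dwv
    where
    b≡d∸k : b ≡ d ∸ k
    b≡d∸k = trans (sym (m+n∸m≡n k b))
      (cong (_∸ k) (subst₂ (λ s t → s + b ≡ t) (dist-unique Duw' Duw) (dist-unique Duv' Duv) a+b≡d'))

module SliceCliques (G : Graph) (c4 : C4Free G) (H : Helly G)
                    {u v : V G} {d : ℕ} (Duv : Dist G u v d) where
  open Graph G using (Adj) renaming (sym to adj-sym)
  open Paths G
  open HellyFacts G H
  open Geodesics G Duv

  Close : V G → V G → Set
  Close x y = x ≢ y → ¬ Adj x y → ⊥

  close-to-clique : ∀ x y → Close x y → x ≡ y ⊎ Adj x y
  close-to-clique x y close with x ≟ y | adj-dec x y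
  ... | yes x≡y | _      = inj₁ x≡y
  ... | no _    | yes xy = inj₂ xy
  ... | no x≢y  | no ¬xy = ⊥-elim (close x≢y ¬xy)

  common-neighbour-in-ball : ∀ {x y c p r} → x ≢ y → ¬ Adj x y → Adj x c → Adj y c →
    (∃ λ x' → Adj x x' × InBall G p r x') → (∃ λ y' → Adj y y' × InBall G p r y') →
    ∃ λ z → Adj x z × Adj y z × InBall G p r z
  common-neighbour-in-ball x≢y ¬xy xc yc (x' , xx' , bx') (y' , yy' , by')
    with helly-3 (_ , adj-ball xc , adj-ball yc) (x' , adj-ball xx' , bx') (y' , adj-ball yy' , by')
  ... | z , bx , by , bz with common-neighbour x≢y ¬xy bx by
  ...   | xz , yz = z , xz , yz , bz

  -- Vertices in N^k[u] and N^b[v] with k + b + 2 = d are neither equal nor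
  -- adjacent: either would give a u–v walk shorter than d.
  far-apart : ∀ {k b z w} → InBall G u k z → InBall G v b w → suc k + suc b ≡ d →
              z ≡ w ⊎ Adj z w → ⊥
  far-apart {k} {b} (e₁ , Duz , e₁≤k) (e₂ , Dvw , e₂≤b) eq (inj₁ refl) =
    no-shortcut (proj₁ Duz) (reverse (proj₁ Dvw))
      (subst (_ <_) eq (s≤s (+-mono-≤ e₁≤k (≤-trans e₂≤b (n≤1+n b)))))
  far-apart {k} {b} (e₁ , Duz , e₁≤k) (e₂ , Dvw , e₂≤b) eq (inj₂ zw) =
    no-shortcut (proj₁ Duz) (step zw (reverse (proj₁ Dvw)))
      (subst (_ <_) eq (s≤s (+-mono-≤ e₁≤k (s≤s e₂≤b))))

  -- At the
  -- ends of the path the level is a single vertex; in the interior a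
  -- counterexample x, y yields the induced 4-cycle x z y w.
  common-neighbour-close : ∀ {k b x y c} → k + b ≡ d → Level k b x → Level k b y →
                           Adj x c → Adj y c → Close x y
  common-neighbour-close {zero} _ (ux , _) (uy , _) _ _ x≢y _ =
    x≢y (trans (sym (dist-0 ux)) (dist-0 uy))
  common-neighbour-close {suc k} {zero} _ (_ , xv) (_ , yv) _ _ x≢y _ =
    x≢y (trans (dist-0 xv) (sym (dist-0 yv)))
  common-neighbour-close {suc k} {suc b} {x} {y} eq (ux , xv) (uy , yv) xc yc x≢y ¬xy
    with common-neighbour-in-ball x≢y ¬xy xc yc (towards-u ux) (towards-u uy)
       | common-neighbour-in-ball x≢y ¬xy xc yc (towards-v xv) (towards-v yv)
    where
    towards-u : ∀ {x} → Dist G u x (suc k) → ∃ λ x' → Adj x x' × InBall G u k x'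
    towards-u D with dist-pred D
    ... | x' , xx' , D' = x' , xx' , dist-ball D'
    towards-v : ∀ {x} → Dist G x v (suc b) → ∃ λ x' → Adj x x' × InBall G v b x'
    towards-v D with dist-pred (dist-sym D)
    ... | x' , xx' , D' = x' , xx' , dist-ball D'
  ... | z , xz , yz , uz | w , xw , yw , vw =
    c4 x z y w x≢y (λ z≡w → far-apart uz vw eq (inj₁ z≡w))
       xz (adj-sym yz) yw (adj-sym xw) ¬xy (λ zw → far-apart uz vw eq (inj₂ zw))

  level-close : ∀ k {b x y} → k + b ≡ d → Level k b x → Level k b y → Close x y
  level-close zero _ (ux , _) (uy , _) x≢y _ = x≢y (trans (sym (dist-0 ux)) (dist-0 uy))
  level-close (suc k) {b} {x} {y} eq lx ly x≢y ¬xy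
    with level-pred eq lx | level-pred eq ly
  ... | x' , xx' , lx' | y' , yy' , ly' =
    level-close k (trans (+-suc k b) eq) lx' ly' x'≢y' predecessors-adjacent
    where
    x'≢y' : x' ≢ y'
    x'≢y' refl = common-neighbour-close eq lx ly xx' yy' x≢y ¬xy

    -- Helly on N[x], N[y'], N^b[v] gives m on the level of x with y' ~ m;
    -- then y and m, or x and y, have a forbidden common neighbour.
    predecessors-adjacent : ¬ Adj x' y'
    predecessors-adjacent x'y'
      with helly-3 {c₁ = x} {1} {y'} {1} {v} {b}
             (x' , adj-ball xx' , adj-ball (adj-sym x'y'))
             (x , centre x 1 , dist-ball (dist-sym (proj₂ lx)))
             (y , adj-ball (adj-sym yy') , dist-ball (dist-sym (proj₂ ly)))
    ... | m , bx , by' , bv = x-meets-m-absurd (ball-1 bx)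
      where
      -- y' is k steps from u, so it cannot lie in N^b[v].
      y'∉ball : ¬ InBall G v b y'
      y'∉ball (e , Dvy' , e≤b) =
        no-shortcut (proj₁ (proj₁ ly')) (reverse (proj₁ Dvy'))
          (subst (_ <_) eq (s≤s (+-monoʳ-≤ k e≤b)))

      y'm : Adj y' m
      y'm with ball-1 by'
      ... | inj₂ e    = e
      ... | inj₁ refl = ⊥-elim (y'∉ball bv)

      lm : Level (suc k) b m
      lm = ball-on-geodesic (snoc (proj₁ (proj₁ ly')) y'm) bv eq

      -- If m = x then y' is a common neighbour of x and y.  If m ~ x then
      -- m and y (common neighbour y') are close, yet m ≠ y since x ≁ y and
      -- m ≁ y since otherwise m is a common neighbour of x and y.
      x-meets-m-absurd : x ≡ m ⊎ Adj x m → ⊥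
      x-meets-m-absurd (inj₁ refl) = common-neighbour-close eq lx ly (adj-sym y'm) yy' x≢y ¬xy
      x-meets-m-absurd (inj₂ xm)   =
        common-neighbour-close eq lm ly (adj-sym y'm) yy'
          (λ { refl → ¬xy xm })
          (λ my → common-neighbour-close eq lx ly xm (adj-sym my) x≢y ¬xy)

lemma8 : (G : Graph) → Connected G → C4Free G → Helly G →
         ∀ u v (k d : ℕ) → Dist G u v d → k ≤ d →
         IsClique G (InSlice G u k v)
lemma8 G _ c4 H u v k d Duv k≤d x y x∈L y∈L =
  close-to-clique x y (level-close k (m+[n∸m]≡n k≤d) (slice-level x∈L) (slice-level y∈L))
  where
  open Geodesics G Duv using (slice-level)
  open SliceCliques G c4 H Duv using (close-to-clique; level-close)
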